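{- Let $a, b$ be positive integers and let $W(x) \in \mathbb{Q}[x]$ have at least two nonzero terms, all of whose exponents are divisible by $5$. If $W(x) \mid Q_{a,b}(x)$ or $W(x) \mid R_{a,b}(x)$, then either $5 \mid a$ and $5 \mid b$, or none of $a, b, a+b, a-b$ is divisible by $5$.
   Context: For positive integers $a,b$: $Q_{a,b}(x) = x^{2a+b} + x^{a+2b} + x^a + x^b - x^{2a+2b} - x^{2a} - x^{2b} - 1$ and $R_{a,b}(x) = x^{2a+b} + x^{a+2b} + x^a + x^b + x^{2a+2b} + x^{2a} + x^{2b} + 1$. -}

module Defs where

open import Data.Nat using (ℕ; zero; suc; _+_; _*_; _∸_; ∣_-_∣)
open import Data.Nat.Divisibility using (_∣_)
open import Data.Rational using (ℚ; 0ℚ; 1ℚ; -_) renaming (_+_ to _+ℚ_; _*_ to _*ℚ_)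
open import Data.List using (List; []; _∷_; replicate; _++_; [_])
open import Data.Product using (Σ; ∃; ∃-syntax; _×_; _,_)
open import Data.Sum using (_⊎_)
open import Relation.Binary.PropositionalEquality using (_≡_; _≢_)
open import Relation.Nullary using (¬_)

-- A polynomial in ℚ[x] is a list of coefficients, lowest degree first.
Poly : Set
Poly = List ℚ

coeff : Poly → ℕ → ℚ
coeff []       _       = 0ℚ
coeff (c ∷ _)  zero    = c
coeff (_ ∷ cs) (suc n) = coeff cs n

_⊕_ : Poly → Poly → Poly
[]       ⊕ q        = q
p        ⊕ []       = p
(c ∷ cs) ⊕ (d ∷ ds) = (c +ℚ d) ∷ (cs ⊕ ds)

infixl 6 _⊕_

mono : ℚ → ℕ → Poly
mono c k = replicate k 0ℚ ++ [ c ]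

sumTo : (ℕ → ℚ) → ℕ → ℚ
sumTo f zero    = f zero
sumTo f (suc n) = sumTo f n +ℚ f (suc n)

mulCoeff : Poly → Poly → ℕ → ℚ
mulCoeff p q n = sumTo (λ i → coeff p i *ℚ coeff q (n ∸ i)) n

_∣ₚ_ : Poly → Poly → Set
W ∣ₚ P = ∃[ V ] (∀ n → coeff P n ≡ mulCoeff W V n)

Qab : ℕ → ℕ → Poly
Qab a b = mono 1ℚ (2 * a + b) ⊕ mono 1ℚ (a + 2 * b) ⊕ mono 1ℚ a ⊕ mono 1ℚ b
        ⊕ mono (- 1ℚ) (2 * a + 2 * b) ⊕ mono (- 1ℚ) (2 * a) ⊕ mono (- 1ℚ) (2 * b) ⊕ mono (- 1ℚ) 0

Rab : ℕ → ℕ → Poly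
Rab a b = mono 1ℚ (2 * a + b) ⊕ mono 1ℚ (a + 2 * b) ⊕ mono 1ℚ a ⊕ mono 1ℚ b
        ⊕ mono 1ℚ (2 * a + 2 * b) ⊕ mono 1ℚ (2 * a) ⊕ mono 1ℚ (2 * b) ⊕ mono 1ℚ 0

AtLeastTwoTerms : Poly → Set
AtLeastTwoTerms W = ∃[ i ] ∃[ j ] (i ≢ j × coeff W i ≢ 0ℚ × coeff W j ≢ 0ℚ)

ExponentsDivBy5 : Poly → Set
ExponentsDivBy5 W = ∀ i → coeff W i ≢ 0ℚ → 5 ∣ i

module Submission where

-- Every exponent of W is a multiple of 5, so W divides, separately, the part of Q_{a,b} or
-- R_{a,b} formed by the terms whose exponents lie in one residue class mod 5. Comparing the
-- lowest and the highest terms of a product shows that a polynomial with two terms divides no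
-- nonzero monomial. Write the terms as x^{2a+b}, x^{a+2b}, x^a, x^b, s x^{2a+2b}, s x^{2a},
-- s x^{2b}, s with s = ∓1, and run through the residues of a and b mod 5. If a ≡ ±b ≢ 0, the
-- class of 0, resp. of 2a, is the single term s, resp. s x^{2a}. If 5 ∣ a but 5 ∤ b, the
-- classes of 0 and of b combine to x^b (x^a + s x^{2a} + s) − s (x^{2a+b} + x^b) = x^{a+b},
-- and symmetrically if 5 ∣ b but 5 ∤ a. What remains is 5 ∣ a, 5 ∣ b, or the generic case.

open import Defs
open import Data.Nat using (ℕ; zero; suc; _+_; _*_; _∸_; _≤_; _<_; z≤n; s≤s; _%_; ∣_-_∣; NonZero)
import Data.Nat.Properties as ℕ
open import Data.Nat.DivMod using (%-distribˡ-+; %-distribˡ-*; %-remove-+ʳ; m%n%n≡m%n; m%n<n)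
open import Data.Nat.Divisibility using (_∣_; n∣m⇒m%n≡0; m%n≡0⇒n∣m)
open import Data.Rational using (ℚ; 0ℚ; 1ℚ; -_) renaming (_+_ to _+ℚ_; _*_ to _*ℚ_)
import Data.Rational.Properties as ℚ
open import Data.Rational.Solver using (module +-*-Solver)
open import Algebra.Apartness.Properties.HeytingCommutativeRing ℚ.heytingCommutativeRing
  using (x#0y#0→xy#0)
open import Algebra.Bundles using (CommutativeRing)
open import Algebra.Properties.CommutativeSemigroup (CommutativeRing.+-commutativeSemigroup ℚ.+-*-commutativeRing)
  using () renaming (interchange to +-interchange)
open import Algebra.Properties.CommutativeSemigroup (CommutativeRing.*-commutativeSemigroup ℚ.+-*-commutativeRing)
  using () renaming (x∙yz≈y∙xz to *-left-comm)
open import Algebra.Properties.CommutativeSemigroup ℕ.+-commutativeSemigroup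
  using () renaming (x∙yz≈y∙xz to +-left-comm)
open import Data.List using (List; []; _∷_; length; map; foldl)
open import Data.Product using (∃-syntax; _×_; _,_; proj₂; map₁; map₂)
open import Data.Sum using (_⊎_; inj₁; inj₂)
open import Data.Empty using (⊥-elim)
open import Function using (_∘_)
open import Relation.Nullary using (¬_; yes; no; contradiction)
open import Relation.Binary.Definitions using (tri<; tri≈; tri>)
open import Relation.Binary.PropositionalEquality
  using (_≡_; _≢_; refl; sym; trans; cong; cong₂; subst; _≗_; module ≡-Reasoning)

sumTo-cong : ∀ {f g} n → (∀ i → i ≤ n → f i ≡ g i) → sumTo f n ≡ sumTo g n
sumTo-cong zero    f≡g = f≡g 0 z≤n
sumTo-cong (suc n) f≡g =
  cong₂ _+ℚ_ (sumTo-cong n (λ i i≤n → f≡g i (ℕ.m≤n⇒m≤1+n i≤n))) (f≡g (suc n) ℕ.≤-refl)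

sumTo-zero : ∀ {f} n → (∀ i → i ≤ n → f i ≡ 0ℚ) → sumTo f n ≡ 0ℚ
sumTo-zero zero    f≡0 = f≡0 0 z≤n
sumTo-zero (suc n) f≡0 =
  cong₂ _+ℚ_ (sumTo-zero n (λ i i≤n → f≡0 i (ℕ.m≤n⇒m≤1+n i≤n))) (f≡0 (suc n) ℕ.≤-refl)

sumTo-+ : ∀ f g n → sumTo (λ i → f i +ℚ g i) n ≡ sumTo f n +ℚ sumTo g n
sumTo-+ f g zero    = refl
sumTo-+ f g (suc n) =
  trans (cong (_+ℚ (f (suc n) +ℚ g (suc n))) (sumTo-+ f g n))
        (+-interchange (sumTo f n) (sumTo g n) (f (suc n)) (g (suc n)))

sumTo-scale : ∀ c f n → sumTo (λ i → c *ℚ f i) n ≡ c *ℚ sumTo f n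
sumTo-scale c f zero    = refl
sumTo-scale c f (suc n) =
  trans (cong (_+ℚ c *ℚ f (suc n)) (sumTo-scale c f n)) (sym (ℚ.*-distribˡ-+ c (sumTo f n) (f (suc n))))

sumTo-single : ∀ {f} n k → k ≤ n → (∀ i → i ≤ n → i ≢ k → f i ≡ 0ℚ) → sumTo f n ≡ f k
sumTo-single {f} zero    zero    _  _   = refl
sumTo-single {f} (suc n) k       k≤ rest with k ℕ.≟ suc n
... | yes refl =
  trans (cong (_+ℚ f (suc n))
              (sumTo-zero n (λ i i≤n → rest i (ℕ.m≤n⇒m≤1+n i≤n) (ℕ.<⇒≢ (s≤s i≤n)))))
        (ℚ.+-identityˡ (f (suc n)))
... | no k≢ =
  trans (cong₂ _+ℚ_ (sumTo-single n k (ℕ.≤-pred (ℕ.≤∧≢⇒< k≤ k≢))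
                                     (λ i i≤n → rest i (ℕ.m≤n⇒m≤1+n i≤n)))
                    (rest (suc n) ℕ.≤-refl (k≢ ∘ sym)))
        (ℚ.+-identityʳ (f k))

sumTo-nonzero : ∀ f n → sumTo f n ≢ 0ℚ → ∃[ i ] f i ≢ 0ℚ
sumTo-nonzero f zero    f0≢0 = 0 , f0≢0
sumTo-nonzero f (suc n) s≢0 with f (suc n) ℚ.≟ 0ℚ
... | no  fn≢0 = suc n , fn≢0
... | yes fn≡0 = sumTo-nonzero f n λ s≡0 →
  s≢0 (trans (cong₂ _+ℚ_ s≡0 fn≡0) (ℚ.+-identityʳ 0ℚ))

-- Convolution and its extreme coefficients

infixl 7 _⋆_

_⋆_ : (ℕ → ℚ) → (ℕ → ℚ) → ℕ → ℚ
(f ⋆ g) n = sumTo (λ i → f i *ℚ g (n ∸ i)) n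

⋆-single : ∀ {f g} p q → (∀ i → i ≤ p + q → i ≢ p → f i *ℚ g (p + q ∸ i) ≡ 0ℚ)
         → (f ⋆ g) (p + q) ≡ f p *ℚ g q
⋆-single {f} {g} p q rest =
  trans (sumTo-single (p + q) p (ℕ.m≤m+n p q) rest) (cong (λ k → f p *ℚ g k) (ℕ.m+n∸m≡n p q))

⋆-lowest : ∀ {f g p q} → (∀ m → m < p → f m ≡ 0ℚ) → (∀ m → m < q → g m ≡ 0ℚ)
         → (f ⋆ g) (p + q) ≡ f p *ℚ g q
⋆-lowest {f} {g} {p} {q} f-below g-below = ⋆-single {f} {g} p q rest
  where
  rest : ∀ i → i ≤ p + q → i ≢ p → f i *ℚ g (p + q ∸ i) ≡ 0ℚ
  rest i i≤ i≢p with ℕ.<-cmp i p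
  ... | tri< i<p _ _ = trans (cong (_*ℚ g (p + q ∸ i)) (f-below i i<p)) (ℚ.*-zeroˡ (g (p + q ∸ i)))
  ... | tri≈ _ i≡p _ = contradiction i≡p i≢p
  ... | tri> _ _ p<i =
    trans (cong (f i *ℚ_) (g-below _ (subst (p + q ∸ i <_) (ℕ.m+n∸m≡n p q) (ℕ.∸-monoʳ-< p<i i≤))))
          (ℚ.*-zeroʳ (f i))

⋆-highest : ∀ {f g p q} → (∀ m → p < m → f m ≡ 0ℚ) → (∀ m → q < m → g m ≡ 0ℚ)
          → (f ⋆ g) (p + q) ≡ f p *ℚ g q
⋆-highest {f} {g} {p} {q} f-above g-above = ⋆-single {f} {g} p q rest
  where
  rest : ∀ i → i ≤ p + q → i ≢ p → f i *ℚ g (p + q ∸ i) ≡ 0ℚ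
  rest i _ i≢p with ℕ.<-cmp i p
  ... | tri< i<p _ _ =
    trans (cong (f i *ℚ_)
                (g-above _ (subst (_< p + q ∸ i) (ℕ.m+n∸m≡n p q) (ℕ.∸-monoʳ-< i<p (ℕ.m≤m+n p q)))))
          (ℚ.*-zeroʳ (f i))
  ... | tri≈ _ i≡p _ = contradiction i≡p i≢p
  ... | tri> _ _ p<i = trans (cong (_*ℚ g (p + q ∸ i)) (f-above i p<i)) (ℚ.*-zeroˡ (g (p + q ∸ i)))

record Span (f : ℕ → ℚ) : Set where
  field
    low high     : ℕ
    low≢0        : f low ≢ 0ℚ
    high≢0       : f high ≢ 0ℚ
    below-low    : ∀ m → m < low → f m ≡ 0ℚ
    above-high   : ∀ m → high < m → f m ≡ 0ℚ

  low≤ : ∀ {m} → f m ≢ 0ℚ → low ≤ m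
  low≤ fm≢0 = ℕ.≮⇒≥ (fm≢0 ∘ below-low _)

  ≤high : ∀ {m} → f m ≢ 0ℚ → m ≤ high
  ≤high fm≢0 = ℕ.≮⇒≥ (fm≢0 ∘ above-high _)

  low≤high : low ≤ high
  low≤high = ≤high low≢0

  single-term : low ≡ high → ∀ {m} → f m ≢ 0ℚ → m ≡ low
  single-term low≡high fm≢0 = ℕ.≤-antisym (subst (_ ≤_) (sym low≡high) (≤high fm≢0)) (low≤ fm≢0)

lowest-below : ∀ (f : ℕ → ℚ) k
             → (∀ m → m < k → f m ≡ 0ℚ) ⊎ ∃[ p ] (f p ≢ 0ℚ × ∀ m → m < p → f m ≡ 0ℚ)
lowest-below f zero    = inj₁ (λ _ ())
lowest-below f (suc k) with lowest-below f k
... | inj₂ lowest = inj₂ lowest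
... | inj₁ below-k with f k ℚ.≟ 0ℚ
...   | no  fk≢0 = inj₂ (k , fk≢0 , below-k)
...   | yes fk≡0 = inj₁ below-suc-k
  where
  below-suc-k : ∀ m → m < suc k → f m ≡ 0ℚ
  below-suc-k m (s≤s m≤k) with ℕ.m≤n⇒m<n∨m≡n m≤k
  ... | inj₁ m<k  = below-k m m<k
  ... | inj₂ refl = fk≡0

highest-below : ∀ (f : ℕ → ℚ) k → (∀ m → k ≤ m → f m ≡ 0ℚ) → ∀ {i} → f i ≢ 0ℚ
              → ∃[ P ] (f P ≢ 0ℚ × ∀ m → P < m → f m ≡ 0ℚ)
highest-below f zero    vanish fi≢0 = contradiction (vanish _ z≤n) fi≢0
highest-below f (suc k) vanish fi≢0 with f k ℚ.≟ 0ℚ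
... | no  fk≢0 = k , fk≢0 , vanish
... | yes fk≡0 = highest-below f k vanish-from-k fi≢0
  where
  vanish-from-k : ∀ m → k ≤ m → f m ≡ 0ℚ
  vanish-from-k m k≤m with ℕ.m≤n⇒m<n∨m≡n k≤m
  ... | inj₁ k<m  = vanish m k<m
  ... | inj₂ refl = fk≡0

span : ∀ {f} k → (∀ m → k ≤ m → f m ≡ 0ℚ) → ∀ {i} → f i ≢ 0ℚ → Span f
span {f} k vanish {i} fi≢0 with lowest-below f (suc i) | highest-below f k vanish fi≢0
... | inj₁ below-i | _ = contradiction (below-i i ℕ.≤-refl) fi≢0
... | inj₂ (p , fp≢0 , below-p) | (P , fP≢0 , above-P) = record
  { low = p ; high = P ; low≢0 = fp≢0 ; high≢0 = fP≢0 ; below-low = below-p ; above-high = above-P }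

xPow : ℕ → ℕ → ℚ
xPow e = coeff (mono 1ℚ e)

xPow-diag : ∀ e → xPow e e ≡ 1ℚ
xPow-diag zero    = refl
xPow-diag (suc e) = xPow-diag e

xPow-off : ∀ {e n} → n ≢ e → xPow e n ≡ 0ℚ
xPow-off {zero}  {zero}  n≢e = contradiction refl n≢e
xPow-off {zero}  {suc n} _   = refl
xPow-off {suc e} {zero}  _   = refl
xPow-off {suc e} {suc n} n≢e = xPow-off (n≢e ∘ cong suc)

coeff-mono : ∀ c e n → coeff (mono c e) n ≡ c *ℚ xPow e n
coeff-mono c zero    zero    = sym (ℚ.*-identityʳ c)
coeff-mono c zero    (suc n) = sym (ℚ.*-zeroʳ c)
coeff-mono c (suc e) zero    = sym (ℚ.*-zeroʳ c)
coeff-mono c (suc e) (suc n) = coeff-mono c e n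

monomial-support : ∀ {c e n} → c *ℚ xPow e n ≢ 0ℚ → n ≡ e
monomial-support {c} {e} {n} ≢0 with n ℕ.≟ e
... | yes n≡e = n≡e
... | no  n≢e = contradiction (trans (cong (c *ℚ_) (xPow-off n≢e)) (ℚ.*-zeroʳ c)) ≢0

-- Divisibility of coefficient sequences

infix 4 _∣ˢ_

record _∣ˢ_ (W : Poly) (f : ℕ → ℚ) : Set where
  constructor divides
  field
    quotient          : ℕ → ℚ
    bound             : ℕ
    quotient-vanishes : ∀ m → bound ≤ m → quotient m ≡ 0ℚ
    factorisation     : f ≗ coeff W ⋆ quotient

coeff-length : ∀ V m → length V ≤ m → coeff V m ≡ 0ℚ
coeff-length []      m       _        = refl
coeff-length (c ∷ V) (suc m) (s≤s le) = coeff-length V m le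

∣ₚ⇒∣ˢ : ∀ {W P} → W ∣ₚ P → W ∣ˢ coeff P
∣ₚ⇒∣ˢ (V , P≡WV) = divides (coeff V) (length V) (coeff-length V) P≡WV

∤-monomial : ∀ {W c e} → AtLeastTwoTerms W → c ≢ 0ℚ → ¬ (W ∣ˢ λ n → c *ℚ xPow e n)
∤-monomial {W} {c} {e} (i , j , i≢j , wi≢0 , wj≢0) c≢0 (divides h L vanish fact) =
  ℕ.<⇒≢ (ℕ.+-mono-<-≤ lowW<highW sh.low≤high)
        (trans (exponent-at (⋆-lowest sW.below-low sh.below-low) sW.low≢0 sh.low≢0)
          (sym (exponent-at (⋆-highest sW.above-high sh.above-high) sW.high≢0 sh.high≢0)))
  where
  w = coeff W

  exponent-at : ∀ {p q} → (w ⋆ h) (p + q) ≡ w p *ℚ h q → w p ≢ 0ℚ → h q ≢ 0ℚ → p + q ≡ e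
  exponent-at {p} {q} extreme wp≢0 hq≢0 =
    monomial-support {c} (λ ≡0 → x#0y#0→xy#0 wp≢0 hq≢0 (trans (sym extreme) (trans (sym (fact (p + q))) ≡0)))

  module sW = Span (span (length W) (coeff-length W) wi≢0)

  lowW<highW : sW.low < sW.high
  lowW<highW = ℕ.≤∧≢⇒< sW.low≤high λ low≡high →
    i≢j (trans (sW.single-term low≡high wi≢0) (sym (sW.single-term low≡high wj≢0)))

  h≢0 : ∃[ k ] h k ≢ 0ℚ
  h≢0 with sumTo-nonzero _ e (λ ≡0 → c≢0 (trans (sym (ℚ.*-identityʳ c))
                                (trans (cong (c *ℚ_) (sym (xPow-diag e))) (trans (fact e) ≡0))))
  ... | k , wk*h≢0 = e ∸ k , λ h≡0 → wk*h≢0 (trans (cong (w k *ℚ_) h≡0) (ℚ.*-zeroʳ (w k)))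

  module sh = Span (span L vanish (proj₂ h≢0))

∣ˢ-resp : ∀ {W f g} → W ∣ˢ f → f ≗ g → W ∣ˢ g
∣ˢ-resp (divides h L vanish fact) f≗g = divides h L vanish (λ n → trans (sym (f≗g n)) (fact n))

∣ˢ-+ : ∀ {W f g} → W ∣ˢ f → W ∣ˢ g → W ∣ˢ (λ n → f n +ℚ g n)
∣ˢ-+ {W} {f} {g} (divides h₁ L₁ vanish₁ fact₁) (divides h₂ L₂ vanish₂ fact₂) =
  divides (λ m → h₁ m +ℚ h₂ m) (L₁ + L₂) vanish fact
  where
  vanish : ∀ m → L₁ + L₂ ≤ m → h₁ m +ℚ h₂ m ≡ 0ℚ
  vanish m le = trans (cong₂ _+ℚ_ (vanish₁ m (ℕ.≤-trans (ℕ.m≤m+n L₁ L₂) le))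
                                  (vanish₂ m (ℕ.≤-trans (ℕ.m≤n+m L₂ L₁) le)))
                      (ℚ.+-identityʳ 0ℚ)
  fact : ∀ n → f n +ℚ g n ≡ (coeff W ⋆ (λ m → h₁ m +ℚ h₂ m)) n
  fact n = trans (cong₂ _+ℚ_ (fact₁ n) (fact₂ n))
    (trans (sym (sumTo-+ _ _ n))
           (sumTo-cong n (λ i _ → sym (ℚ.*-distribˡ-+ (coeff W i) (h₁ (n ∸ i)) (h₂ (n ∸ i))))))

∣ˢ-scale : ∀ {W f} c → W ∣ˢ f → W ∣ˢ (λ n → c *ℚ f n)
∣ˢ-scale {W} c (divides h L vanish fact) =
  divides (λ m → c *ℚ h m) L (λ m le → trans (cong (c *ℚ_) (vanish m le)) (ℚ.*-zeroʳ c))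
    λ n → trans (cong (c *ℚ_) (fact n))
      (trans (sym (sumTo-scale c _ n))
             (sumTo-cong n (λ i _ → *-left-comm c (coeff W i) (h (n ∸ i)))))

infixr 8 x·_ x^_·_

x·_ : (ℕ → ℚ) → ℕ → ℚ
(x· f) zero    = 0ℚ
(x· f) (suc n) = f n

x^_·_ : ℕ → (ℕ → ℚ) → ℕ → ℚ
x^ zero  · f = f
x^ suc k · f = x· (x^ k · f)

∣ˢ-x· : ∀ {W f} → W ∣ˢ f → W ∣ˢ x· f
∣ˢ-x· {W} {f} (divides h L vanish fact) = divides (x· h) (suc L) vanish′ fact′
  where
  w = coeff W
  vanish′ : ∀ m → suc L ≤ m → (x· h) m ≡ 0ℚ
  vanish′ (suc m) (s≤s le) = vanish m le
  fact′ : ∀ n → (x· f) n ≡ (w ⋆ x· h) n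
  fact′ zero    = sym (ℚ.*-zeroʳ (w 0))
  fact′ (suc n) = begin
    f n                                          ≡⟨ fact n ⟩
    sumTo (λ i → w i *ℚ h (n ∸ i)) n             ≡⟨ sumTo-cong n shifted ⟩
    sumTo (λ i → w i *ℚ (x· h) (suc n ∸ i)) n    ≡⟨ ℚ.+-identityʳ _ ⟨
    sumTo (λ i → w i *ℚ (x· h) (suc n ∸ i)) n +ℚ 0ℚ
      ≡⟨ cong (sumTo (λ i → w i *ℚ (x· h) (suc n ∸ i)) n +ℚ_) top-term ⟨
    (w ⋆ x· h) (suc n)                           ∎
    where
    open ≡-Reasoning
    shifted : ∀ i → i ≤ n → w i *ℚ h (n ∸ i) ≡ w i *ℚ (x· h) (suc n ∸ i)
    shifted i i≤n = cong (λ k → w i *ℚ (x· h) k) (sym (ℕ.+-∸-assoc 1 i≤n))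
    top-term : w (suc n) *ℚ (x· h) (suc n ∸ suc n) ≡ 0ℚ
    top-term = trans (cong (λ k → w (suc n) *ℚ (x· h) k) (ℕ.n∸n≡0 n)) (ℚ.*-zeroʳ (w (suc n)))

∣ˢ-x^· : ∀ {W f} k → W ∣ˢ f → W ∣ˢ x^ k · f
∣ˢ-x^· zero    W∣f = W∣f
∣ˢ-x^· (suc k) W∣f = ∣ˢ-x· (∣ˢ-x^· k W∣f)

x^·-xPow : ∀ k e → x^ k · xPow e ≗ xPow (k + e)
x^·-xPow zero    e n       = refl
x^·-xPow (suc k) e zero    = refl
x^·-xPow (suc k) e (suc n) = x^·-xPow k e n

x^·-+ : ∀ k f g → x^ k · (λ n → f n +ℚ g n) ≗ (λ n → (x^ k · f) n +ℚ (x^ k · g) n)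
x^·-+ zero    f g n       = refl
x^·-+ (suc k) f g zero    = sym (ℚ.+-identityʳ 0ℚ)
x^·-+ (suc k) f g (suc n) = x^·-+ k f g n

x^·-scale : ∀ k c f → x^ k · (λ n → c *ℚ f n) ≗ (λ n → c *ℚ (x^ k · f) n)
x^·-scale zero    c f n       = refl
x^·-scale (suc k) c f zero    = sym (ℚ.*-zeroʳ c)
x^·-scale (suc k) c f (suc n) = x^·-scale k c f n

x^·-zero : ∀ k → x^ k · (λ _ → 0ℚ) ≗ (λ _ → 0ℚ)
x^·-zero zero    n       = refl
x^·-zero (suc k) zero    = refl
x^·-zero (suc k) (suc n) = x^·-zero k n

-- Residue classes of exponents

ExponentsDivisibleBy : ℕ → Poly → Set
ExponentsDivisibleBy m W = ∀ i → coeff W i ≢ 0ℚ → m ∣ i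

section : (m : ℕ) .{{_ : NonZero m}} → ℕ → (ℕ → ℚ) → ℕ → ℚ
section m r f n with n % m ℕ.≟ r
... | yes _ = f n
... | no  _ = 0ℚ

section-in : ∀ {m} .{{_ : NonZero m}} {r f n} → n % m ≡ r → section m r f n ≡ f n
section-in {m} {r = r} {n = n} n≡r with n % m ℕ.≟ r
... | yes _   = refl
... | no  n≢r = contradiction n≡r n≢r

section-out : ∀ {m} .{{_ : NonZero m}} {r f n} → n % m ≢ r → section m r f n ≡ 0ℚ
section-out {m} {r = r} {n = n} n≢r with n % m ℕ.≟ r
... | yes n≡r = contradiction n≡r n≢r
... | no  _   = refl

section-+ : ∀ {m} .{{_ : NonZero m}} r f g n
          → section m r (λ k → f k +ℚ g k) n ≡ section m r f n +ℚ section m r g n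
section-+ {m} r f g n with n % m ℕ.≟ r
... | yes _ = refl
... | no  _ = sym (ℚ.+-identityʳ 0ℚ)

section-zero : ∀ {m} .{{_ : NonZero m}} r n → section m r (λ _ → 0ℚ) n ≡ 0ℚ
section-zero {m} r n with n % m ℕ.≟ r
... | yes _ = refl
... | no  _ = refl

section-monomial-in : ∀ {m} .{{_ : NonZero m}} {r e} c n → e % m ≡ r
                    → section m r (λ k → c *ℚ xPow e k) n ≡ c *ℚ xPow e n
section-monomial-in {m} {r} {e} c n e≡r with n % m ℕ.≟ r
... | yes _   = refl
... | no  n≢r = sym (trans (cong (c *ℚ_) (xPow-off {e} λ { refl → n≢r e≡r })) (ℚ.*-zeroʳ c))

section-monomial-out : ∀ {m} .{{_ : NonZero m}} {r e} c n → e % m ≢ r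
                     → section m r (λ k → c *ℚ xPow e k) n ≡ 0ℚ
section-monomial-out {m} {r} {e} c n e≢r with n % m ℕ.≟ r
... | yes n≡r = trans (cong (c *ℚ_) (xPow-off {e} λ { refl → e≢r n≡r })) (ℚ.*-zeroʳ c)
... | no  _   = refl

%-remove-∸ʳ : ∀ {m} .{{_ : NonZero m}} {i n} → m ∣ i → i ≤ n → (n ∸ i) % m ≡ n % m
%-remove-∸ʳ {m} {i} {n} m∣i i≤n =
  trans (sym (%-remove-+ʳ (n ∸ i) m∣i)) (cong (_% m) (ℕ.m∸n+n≡m i≤n))

∣ˢ-section : ∀ {m} .{{_ : NonZero m}} {W f} r → ExponentsDivisibleBy m W → W ∣ˢ f → W ∣ˢ section m r f
∣ˢ-section {m} {W} {f} r exps (divides h L vanish fact) = divides (section m r h) L vanish′ fact′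
  where
  w = coeff W
  vanish′ : ∀ k → L ≤ k → section m r h k ≡ 0ℚ
  vanish′ k le with k % m ℕ.≟ r
  ... | yes _ = vanish k le
  ... | no  _ = refl
  annihilated : ∀ {i} → w i ≡ 0ℚ → ∀ x → w i *ℚ x ≡ 0ℚ
  annihilated wi≡0 x = trans (cong (_*ℚ x) wi≡0) (ℚ.*-zeroˡ x)
  term-in : ∀ {n} → n % m ≡ r → ∀ i → i ≤ n → w i *ℚ h (n ∸ i) ≡ w i *ℚ section m r h (n ∸ i)
  term-in {n} n≡r i i≤n with w i ℚ.≟ 0ℚ
  ... | yes wi≡0 = trans (annihilated wi≡0 _) (sym (annihilated wi≡0 _))
  ... | no  wi≢0 = cong (w i *ℚ_) (sym (section-in (trans (%-remove-∸ʳ (exps i wi≢0) i≤n) n≡r)))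
  term-out : ∀ {n} → n % m ≢ r → ∀ i → i ≤ n → w i *ℚ section m r h (n ∸ i) ≡ 0ℚ
  term-out {n} n≢r i i≤n with w i ℚ.≟ 0ℚ
  ... | yes wi≡0 = annihilated wi≡0 _
  ... | no  wi≢0 = trans (cong (w i *ℚ_) (section-out (n≢r ∘ trans (sym (%-remove-∸ʳ (exps i wi≢0) i≤n)))))
                         (ℚ.*-zeroʳ (w i))
  fact′ : ∀ n → section m r f n ≡ (w ⋆ section m r h) n
  fact′ n with n % m ℕ.≟ r
  ... | yes n≡r = trans (fact n) (sumTo-cong n (term-in n≡r))
  ... | no  n≢r = sym (sumTo-zero n (term-out n≢r))

-- Polynomials in x^a and x^b

Term : Set
Term = ℚ × ℕ × ℕ

-- i ⊙ x is i * x, but 1 ⊙ x reduces to x: this makes foldl (addTerm a b) [] (terms s)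
-- reduce to Qab a b for s = - 1ℚ and to Rab a b for s = 1ℚ.
_⊙_ : ℕ → ℕ → ℕ
1 ⊙ x = x
i ⊙ x = i * x

exponent : ℕ × ℕ → ℕ → ℕ → ℕ
exponent (i , zero)  a b = i ⊙ a
exponent (i , suc j) a b = i ⊙ a + suc j ⊙ b

⊙-≡ : ∀ i x → i ⊙ x ≡ i * x
⊙-≡ 0             x = refl
⊙-≡ 1             x = sym (ℕ.+-identityʳ x)
⊙-≡ (suc (suc i)) x = refl

exponent-≡ : ∀ i j a b → exponent (i , j) a b ≡ i * a + j * b
exponent-≡ i zero    a b = trans (⊙-≡ i a) (sym (ℕ.+-identityʳ (i * a)))
exponent-≡ i (suc j) a b = cong₂ _+_ (⊙-≡ i a) (⊙-≡ (suc j) b)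

eval : ℕ → ℕ → List Term → ℕ → ℚ
eval a b []              n = 0ℚ
eval a b ((c , ij) ∷ ts) n = c *ℚ xPow (exponent ij a b) n +ℚ eval a b ts n

addTerm : ℕ → ℕ → Poly → Term → Poly
addTerm a b p (c , ij) = p ⊕ mono c (exponent ij a b)

coeff-⊕ : ∀ p q n → coeff (p ⊕ q) n ≡ coeff p n +ℚ coeff q n
coeff-⊕ []       q        n       = sym (ℚ.+-identityˡ (coeff q n))
coeff-⊕ (c ∷ cs) []       n       = sym (ℚ.+-identityʳ (coeff (c ∷ cs) n))
coeff-⊕ (c ∷ cs) (d ∷ ds) zero    = refl
coeff-⊕ (c ∷ cs) (d ∷ ds) (suc n) = coeff-⊕ cs ds n

coeff-foldl-addTerm : ∀ a b p ts → coeff (foldl (addTerm a b) p ts) ≗ λ n → coeff p n +ℚ eval a b ts n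
coeff-foldl-addTerm a b p []              n = sym (ℚ.+-identityʳ (coeff p n))
coeff-foldl-addTerm a b p ((c , ij) ∷ ts) n = begin
  coeff (foldl (addTerm a b) (p ⊕ mono c e) ts) n     ≡⟨ coeff-foldl-addTerm a b (p ⊕ mono c e) ts n ⟩
  coeff (p ⊕ mono c e) n +ℚ eval a b ts n             ≡⟨ cong (_+ℚ eval a b ts n) (coeff-⊕ p (mono c e) n) ⟩
  (coeff p n +ℚ coeff (mono c e) n) +ℚ eval a b ts n
    ≡⟨ ℚ.+-assoc (coeff p n) (coeff (mono c e) n) (eval a b ts n) ⟩
  coeff p n +ℚ (coeff (mono c e) n +ℚ eval a b ts n)
    ≡⟨ cong (λ x → coeff p n +ℚ (x +ℚ eval a b ts n)) (coeff-mono c e n) ⟩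
  coeff p n +ℚ eval a b ((c , ij) ∷ ts) n             ∎
  where
  open ≡-Reasoning
  e = exponent ij a b

∣ₚ⇒∣ˢ-eval : ∀ {W} a b ts → W ∣ₚ foldl (addTerm a b) [] ts → W ∣ˢ eval a b ts
∣ₚ⇒∣ˢ-eval a b ts W∣P = ∣ˢ-resp (∣ₚ⇒∣ˢ {P = foldl (addTerm a b) [] ts} W∣P) λ n →
  trans (coeff-foldl-addTerm a b [] ts n) (ℚ.+-identityˡ (eval a b ts n))

residue : (m : ℕ) .{{_ : NonZero m}} → ℕ → ℕ → Term → ℕ
residue m α β (_ , i , j) = (i * α + j * β) % m

sectionTerms : (m : ℕ) .{{_ : NonZero m}} → ℕ → ℕ → ℕ → List Term → List Term
sectionTerms m α β r []       = []
sectionTerms m α β r (t ∷ ts) with residue m α β t ℕ.≟ r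
... | yes _ = t ∷ sectionTerms m α β r ts
... | no  _ = sectionTerms m α β r ts

[i*x]%m≡[i*[x%m]]%m : ∀ {m} .{{_ : NonZero m}} i x → (i * x) % m ≡ (i * (x % m)) % m
[i*x]%m≡[i*[x%m]]%m {m} i x = begin
  (i * x) % m                    ≡⟨ %-distribˡ-* i x m ⟩
  ((i % m) * (x % m)) % m        ≡⟨ cong (λ y → ((i % m) * y) % m) (m%n%n≡m%n x m) ⟨
  ((i % m) * (x % m % m)) % m    ≡⟨ %-distribˡ-* i (x % m) m ⟨
  (i * (x % m)) % m              ∎
  where open ≡-Reasoning

exponent-% : ∀ {m} .{{_ : NonZero m}} {a b α β} → a % m ≡ α → b % m ≡ β
           → ∀ t → exponent (proj₂ t) a b % m ≡ residue m α β t
exponent-% {m} {a} {b} {α} {β} ea eb (c , i , j) = begin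
  exponent (i , j) a b % m                        ≡⟨ cong (_% m) (exponent-≡ i j a b) ⟩
  (i * a + j * b) % m                             ≡⟨ %-distribˡ-+ (i * a) (j * b) m ⟩
  ((i * a) % m + (j * b) % m) % m
    ≡⟨ cong₂ (λ x y → (x + y) % m) ([i*x]%m≡[i*[x%m]]%m i a) ([i*x]%m≡[i*[x%m]]%m j b) ⟩
  ((i * (a % m)) % m + (j * (b % m)) % m) % m     ≡⟨ %-distribˡ-+ (i * (a % m)) (j * (b % m)) m ⟨
  (i * (a % m) + j * (b % m)) % m                 ≡⟨ cong₂ (λ x y → (i * x + j * y) % m) ea eb ⟩
  (i * α + j * β) % m                             ∎
  where open ≡-Reasoning

section-eval : ∀ {m} .{{_ : NonZero m}} {a b α β} → a % m ≡ α → b % m ≡ β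
             → ∀ r ts → section m r (eval a b ts) ≗ eval a b (sectionTerms m α β r ts)
section-eval {m} ea eb r [] n = section-zero r n
section-eval {m} {a} {b} {α} {β} ea eb r ((c , ij) ∷ ts) n with residue m α β (c , ij) ℕ.≟ r
... | yes e≡r = trans (section-+ r _ (eval a b ts) n)
  (cong₂ _+ℚ_ (section-monomial-in c n (trans (exponent-% ea eb (c , ij)) e≡r)) (section-eval ea eb r ts n))
... | no  e≢r = trans (section-+ r _ (eval a b ts) n)
  (trans (cong₂ _+ℚ_ (section-monomial-out c n (e≢r ∘ trans (sym (exponent-% ea eb (c , ij)))))
                     (section-eval ea eb r ts n))
         (ℚ.+-identityˡ _))

∣ˢ-sectionTerms : ∀ {m} .{{_ : NonZero m}} {W a b α β} → ExponentsDivisibleBy m W → a % m ≡ α → b % m ≡ β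
                → ∀ r {ts} → W ∣ˢ eval a b ts → W ∣ˢ eval a b (sectionTerms m α β r ts)
∣ˢ-sectionTerms exps ea eb r {ts} W∣ts = ∣ˢ-resp (∣ˢ-section r exps W∣ts) (section-eval ea eb r ts)

exponent-raiseˡ : ∀ a b ij → a + exponent ij a b ≡ exponent (map₁ suc ij) a b
exponent-raiseˡ a b (i , j) = begin
  a + exponent (i , j) a b    ≡⟨ cong (a +_) (exponent-≡ i j a b) ⟩
  a + (i * a + j * b)         ≡⟨ ℕ.+-assoc a (i * a) (j * b) ⟨
  suc i * a + j * b           ≡⟨ exponent-≡ (suc i) j a b ⟨
  exponent (suc i , j) a b    ∎
  where open ≡-Reasoning

exponent-raiseʳ : ∀ a b ij → b + exponent ij a b ≡ exponent (map₂ suc ij) a b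
exponent-raiseʳ a b (i , j) = begin
  b + exponent (i , j) a b    ≡⟨ cong (b +_) (exponent-≡ i j a b) ⟩
  b + (i * a + j * b)         ≡⟨ +-left-comm b (i * a) (j * b) ⟩
  i * a + suc j * b           ≡⟨ exponent-≡ i (suc j) a b ⟨
  exponent (i , suc j) a b    ∎
  where open ≡-Reasoning

x^·-eval : ∀ {a b} k (g : ℕ × ℕ → ℕ × ℕ) → (∀ ij → k + exponent ij a b ≡ exponent (g ij) a b)
         → ∀ ts → x^ k · eval a b ts ≗ eval a b (map (map₂ g) ts)
x^·-eval k g raise []              n = x^·-zero k n
x^·-eval {a} {b} k g raise ((c , ij) ∷ ts) n =
  trans (x^·-+ k (λ m → c *ℚ xPow e m) (eval a b ts) n)
        (cong₂ _+ℚ_ (trans (x^·-scale k c (xPow e) n)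
                           (cong (c *ℚ_) (trans (x^·-xPow k e n) (cong (λ e′ → xPow e′ n) (raise ij)))))
                    (x^·-eval k g raise ts n))
  where e = exponent ij a b

-- x^k (x^e + s x^u + s x^v) − s (x^(k+u) + x^(k+v)) = x^(k+e)
x^·-cancel : ∀ {W a b s ij u v} k (g : ℕ × ℕ → ℕ × ℕ)
           → (∀ ij → k + exponent ij a b ≡ exponent (g ij) a b)
           → W ∣ˢ eval a b ((1ℚ , ij) ∷ (s , u) ∷ (s , v) ∷ [])
           → W ∣ˢ eval a b ((1ℚ , g u) ∷ (1ℚ , g v) ∷ [])
           → W ∣ˢ eval a b ((1ℚ , g ij) ∷ [])
x^·-cancel {a = a} {b} {s} {ij} {u} {v} k g raise W∣f W∣g =
  ∣ˢ-resp (∣ˢ-+ (∣ˢ-resp (∣ˢ-x^· k W∣f) (x^·-eval k g raise ((1ℚ , ij) ∷ (s , u) ∷ (s , v) ∷ [])))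
                (∣ˢ-scale (- s) W∣g))
          (λ n → cancel (xPow (exponent (g ij) a b) n) (xPow (exponent (g u) a b) n) (xPow (exponent (g v) a b) n))
  where
  open +-*-Solver
  cancel : ∀ x y z → (1ℚ *ℚ x +ℚ (s *ℚ y +ℚ (s *ℚ z +ℚ 0ℚ)))
                       +ℚ (- s) *ℚ (1ℚ *ℚ y +ℚ (1ℚ *ℚ z +ℚ 0ℚ))
                   ≡ 1ℚ *ℚ x +ℚ 0ℚ
  cancel = solve 4 (λ s x y z → (con 1ℚ :* x :+ (s :* y :+ (s :* z :+ con 0ℚ)))
                                  :+ (:- s) :* (con 1ℚ :* y :+ (con 1ℚ :* z :+ con 0ℚ))
                              := con 1ℚ :* x :+ con 0ℚ) refl s

m∣∣a-b∣⇒a%m≡b%m : ∀ {m} .{{_ : NonZero m}} a b → m ∣ ∣ a - b ∣ → a % m ≡ b % m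
m∣∣a-b∣⇒a%m≡b%m {m} a b m∣∣a-b∣ with ℕ.≤-total a b
... | inj₁ a≤b = sym (trans (cong (_% m) (sym (ℕ.m+[n∸m]≡n a≤b)))
                            (%-remove-+ʳ a (subst (m ∣_) (ℕ.m≤n⇒∣m-n∣≡n∸m a≤b) m∣∣a-b∣)))
... | inj₂ b≤a = trans (cong (_% m) (sym (ℕ.m+[n∸m]≡n b≤a)))
                       (%-remove-+ʳ b (subst (m ∣_) (trans (ℕ.∣-∣-comm a b) (ℕ.m≤n⇒∣m-n∣≡n∸m b≤a))
                                             m∣∣a-b∣))

none-divisible : ∀ {m} .{{_ : NonZero m}} {a b α β} → a % m ≡ α → b % m ≡ β
               → α ≢ 0 → β ≢ 0 → (α + β) % m ≢ 0 → α ≢ β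
               → ¬ (m ∣ a) × ¬ (m ∣ b) × ¬ (m ∣ (a + b)) × ¬ (m ∣ ∣ a - b ∣)
none-divisible {m} {a} {b} ea eb α≢0 β≢0 α+β≢0 α≢β =
    (λ m∣a → α≢0 (trans (sym ea) (n∣m⇒m%n≡0 a m m∣a)))
  , (λ m∣b → β≢0 (trans (sym eb) (n∣m⇒m%n≡0 b m m∣b)))
  , (λ m∣a+b → α+β≢0 (trans (cong₂ (λ x y → (x + y) % m) (sym ea) (sym eb))
                            (trans (sym (%-distribˡ-+ a b m)) (n∣m⇒m%n≡0 (a + b) m m∣a+b))))
  , (λ m∣∣a-b∣ → α≢β (trans (sym ea) (trans (m∣∣a-b∣⇒a%m≡b%m a b m∣∣a-b∣) eb)))

BothOrNoneDivisible : ℕ → ℕ → ℕ → Set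
BothOrNoneDivisible m a b =
  (m ∣ a × m ∣ b) ⊎ (¬ (m ∣ a) × ¬ (m ∣ b) × ¬ (m ∣ (a + b)) × ¬ (m ∣ ∣ a - b ∣))

terms : ℚ → List Term
terms s = (1ℚ , 2 , 1) ∷ (1ℚ , 1 , 2) ∷ (1ℚ , 1 , 0) ∷ (1ℚ , 0 , 1)
        ∷ (s , 2 , 2) ∷ (s , 2 , 0) ∷ (s , 0 , 2) ∷ (s , 0 , 0) ∷ []

module _ {W s a b} (two : AtLeastTwoTerms W) (exps : ExponentsDivBy5 W) (s≢0 : s ≢ 0ℚ)
         (W∣P : W ∣ˢ eval a b (terms s)) where

  private
    residue-class : ∀ {α β} → a % 5 ≡ α → b % 5 ≡ β → ∀ r
                  → W ∣ˢ eval a b (sectionTerms 5 α β r (terms s))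
    residue-class ea eb r = ∣ˢ-sectionTerms {a = a} {b} exps ea eb r {terms s} W∣P

    ∤-term : ∀ c ij → c ≢ 0ℚ → ¬ (W ∣ˢ eval a b ((c , ij) ∷ []))
    ∤-term c ij c≢0 W∣t =
      ∤-monomial {e = exponent ij a b} two c≢0
        (∣ˢ-resp W∣t (λ n → ℚ.+-identityʳ (c *ℚ xPow (exponent ij a b) n)))

    only-a-divisible : W ∣ˢ eval a b ((1ℚ , 1 , 0) ∷ (s , 2 , 0) ∷ (s , 0 , 0) ∷ [])
                     → ¬ (W ∣ˢ eval a b ((1ℚ , 2 , 1) ∷ (1ℚ , 0 , 1) ∷ []))
    only-a-divisible W∣f W∣g =
      ∤-term 1ℚ (1 , 1) ℚ.1≢0
        (x^·-cancel {s = s} {1 , 0} {2 , 0} {0 , 0} b (map₂ suc) (exponent-raiseʳ a b) W∣f W∣g)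

    only-b-divisible : W ∣ˢ eval a b ((1ℚ , 0 , 1) ∷ (s , 0 , 2) ∷ (s , 0 , 0) ∷ [])
                     → ¬ (W ∣ˢ eval a b ((1ℚ , 1 , 2) ∷ (1ℚ , 1 , 0) ∷ []))
    only-b-divisible W∣f W∣g =
      ∤-term 1ℚ (1 , 1) ℚ.1≢0
        (x^·-cancel {s = s} {0 , 1} {0 , 2} {0 , 0} a (map₁ suc) (exponent-raiseˡ a b) W∣f W∣g)

    residue<5 : ∀ {x α} → x % 5 ≡ α → α < 5
    residue<5 {x} e = subst (_< 5) e (m%n<n x 5)

  residue-cases : ∀ α β → a % 5 ≡ α → b % 5 ≡ β → BothOrNoneDivisible 5 a b
  residue-cases 0 0 ea eb = inj₁ (m%n≡0⇒n∣m a 5 ea , m%n≡0⇒n∣m b 5 eb)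
  residue-cases 0 1 ea eb = ⊥-elim (only-a-divisible (residue-class ea eb 0) (residue-class ea eb 1))
  residue-cases 0 2 ea eb = ⊥-elim (only-a-divisible (residue-class ea eb 0) (residue-class ea eb 2))
  residue-cases 0 3 ea eb = ⊥-elim (only-a-divisible (residue-class ea eb 0) (residue-class ea eb 3))
  residue-cases 0 4 ea eb = ⊥-elim (only-a-divisible (residue-class ea eb 0) (residue-class ea eb 4))
  residue-cases 1 0 ea eb = ⊥-elim (only-b-divisible (residue-class ea eb 0) (residue-class ea eb 1))
  residue-cases 2 0 ea eb = ⊥-elim (only-b-divisible (residue-class ea eb 0) (residue-class ea eb 2))
  residue-cases 3 0 ea eb = ⊥-elim (only-b-divisible (residue-class ea eb 0) (residue-class ea eb 3))
  residue-cases 4 0 ea eb = ⊥-elim (only-b-divisible (residue-class ea eb 0) (residue-class ea eb 4))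
  residue-cases 1 1 ea eb = ⊥-elim (∤-term s (0 , 0) s≢0 (residue-class ea eb 0))
  residue-cases 2 2 ea eb = ⊥-elim (∤-term s (0 , 0) s≢0 (residue-class ea eb 0))
  residue-cases 3 3 ea eb = ⊥-elim (∤-term s (0 , 0) s≢0 (residue-class ea eb 0))
  residue-cases 4 4 ea eb = ⊥-elim (∤-term s (0 , 0) s≢0 (residue-class ea eb 0))
  residue-cases 1 4 ea eb = ⊥-elim (∤-term s (2 , 0) s≢0 (residue-class ea eb 2))
  residue-cases 2 3 ea eb = ⊥-elim (∤-term s (2 , 0) s≢0 (residue-class ea eb 4))
  residue-cases 3 2 ea eb = ⊥-elim (∤-term s (2 , 0) s≢0 (residue-class ea eb 1))
  residue-cases 4 1 ea eb = ⊥-elim (∤-term s (2 , 0) s≢0 (residue-class ea eb 3))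
  residue-cases 1 2 ea eb = inj₂ (none-divisible ea eb (λ ()) (λ ()) (λ ()) (λ ()))
  residue-cases 1 3 ea eb = inj₂ (none-divisible ea eb (λ ()) (λ ()) (λ ()) (λ ()))
  residue-cases 2 1 ea eb = inj₂ (none-divisible ea eb (λ ()) (λ ()) (λ ()) (λ ()))
  residue-cases 2 4 ea eb = inj₂ (none-divisible ea eb (λ ()) (λ ()) (λ ()) (λ ()))
  residue-cases 3 1 ea eb = inj₂ (none-divisible ea eb (λ ()) (λ ()) (λ ()) (λ ()))
  residue-cases 3 4 ea eb = inj₂ (none-divisible ea eb (λ ()) (λ ()) (λ ()) (λ ()))
  residue-cases 4 2 ea eb = inj₂ (none-divisible ea eb (λ ()) (λ ()) (λ ()) (λ ()))
  residue-cases 4 3 ea eb = inj₂ (none-divisible ea eb (λ ()) (λ ()) (λ ()) (λ ()))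
  residue-cases (suc (suc (suc (suc (suc α))))) β ea eb = contradiction (residue<5 {a} ea) (ℕ.m+n≮m 5 α)
  residue-cases α (suc (suc (suc (suc (suc β))))) ea eb = contradiction (residue<5 {b} eb) (ℕ.m+n≮m 5 β)

lemma6p7 : (a b : ℕ) → NonZero a → NonZero b → (W : Poly)
    → AtLeastTwoTerms W → ExponentsDivBy5 W
    → (W ∣ₚ Qab a b) ⊎ (W ∣ₚ Rab a b)
    → (5 ∣ a × 5 ∣ b)
      ⊎ (¬ (5 ∣ a) × ¬ (5 ∣ b) × ¬ (5 ∣ (a + b)) × ¬ (5 ∣ ∣ a - b ∣))
lemma6p7 a b _ _ W two exps (inj₁ W∣Q) =
  residue-cases {W} { - 1ℚ} {a} {b} two exps (λ ()) (∣ₚ⇒∣ˢ-eval a b (terms (- 1ℚ)) W∣Q)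
                (a % 5) (b % 5) refl refl
lemma6p7 a b _ _ W two exps (inj₂ W∣R) =
  residue-cases {W} {1ℚ} {a} {b} two exps ℚ.1≢0 (∣ₚ⇒∣ˢ-eval a b (terms 1ℚ) W∣R)
                (a % 5) (b % 5) refl refl
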